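{- Let $n\ge 4$ and $k\ge1$ be integers. Then \[ \gamma_{[k]R}(C_6\Box P_n)\le 6(n-2)\left\lceil\frac{k+4}{5}\right\rceil+12\left\lceil\frac{k+3-\left\lceil\frac{k+4}{5}\right\rceil}{3}\right\rceil\le\frac{6nk+54n+4k-4}{5}. \]
   Context: For a graph $G$ and $v\in V(G)$, $N(v)$ is the open neighborhood and $N[v]=N(v)\cup\{v\}$. For an integer $k\ge1$, a function $f:V(G)\to\{0,1,\dots,k+1\}$ is a $[k]$-Roman dominating function if for every vertex $v$ with $f(v)<k$ we have $\sum_{u\in N[v]}f(u)\ge k+|\{u\in N(v): f(u)>0\}|$. The weight of $f$ is $\sum_{v}f(v)$, and $\gamma_{[k]R}(G)$ is the minimum weight of a $[k]$-Roman dominating function on $G$. $C_m\Box P_n$ is the Cartesian product of the cycle $C_m$ (vertices $0,\dots,m-1$ mod $m$) and the path $P_n$ (vertices $0,\dots,n-1$): $(i,j)\sim(i',j')$ iff ($i=i'$ and $|j-j'|=1$) or ($j=j'$ and $i'\equiv i\pm1 \pmod m$). -}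

module Defs where

open import Data.Nat using (ℕ; zero; suc; _+_; _*_; _∸_; _≤_; _<_; _≡ᵇ_; _<ᵇ_; _/_)
open import Data.Nat.DivMod using (_%_)
open import Data.Bool using (Bool; true; false; _∨_; _∧_)
open import Data.Fin using (Fin; toℕ)
open import Data.Nat.ListAction using (sum)
open import Data.List using (List; map; length; filterᵇ; allFin; cartesianProduct)
open import Data.Product using (_×_; _,_; ∃)

-- Vertices of C_m □ P_n : pairs (i , j), i ∈ C_m (indices mod m), j ∈ P_n.
Vertex : ℕ → ℕ → Set
Vertex m n = Fin m × Fin n

vertices : (m n : ℕ) → List (Vertex m n)
vertices m n = cartesianProduct (allFin m) (allFin n)

cycAdj : (m : ℕ) → Fin m → Fin m → Bool
cycAdj zero    i i' = false
cycAdj (suc m) i i' =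
  (toℕ i' ≡ᵇ ((toℕ i + 1) % suc m)) ∨ (toℕ i ≡ᵇ ((toℕ i' + 1) % suc m))

pathAdj : (n : ℕ) → Fin n → Fin n → Bool
pathAdj n j j' = (toℕ j' ≡ᵇ suc (toℕ j)) ∨ (toℕ j ≡ᵇ suc (toℕ j'))

adj : (m n : ℕ) → Vertex m n → Vertex m n → Bool
adj m n (i , j) (i' , j') =
  ((toℕ i ≡ᵇ toℕ i') ∧ pathAdj n j j') ∨ ((toℕ j ≡ᵇ toℕ j') ∧ cycAdj m i i')

N : (m n : ℕ) → Vertex m n → List (Vertex m n)
N m n v = filterᵇ (adj m n v) (vertices m n)

closedSum : (m n : ℕ) → (Vertex m n → ℕ) → Vertex m n → ℕ
closedSum m n f v = f v + sum (map f (N m n v))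

activeNbrs : (m n : ℕ) → (Vertex m n → ℕ) → Vertex m n → ℕ
activeNbrs m n f v = length (filterᵇ (λ u → 0 <ᵇ f u) (N m n v))

weight : (m n : ℕ) → (Vertex m n → ℕ) → ℕ
weight m n f = sum (map f (vertices m n))

IsKRDF : (k m n : ℕ) → (Vertex m n → ℕ) → Set
IsKRDF k m n f =
  (∀ v → f v ≤ k + 1) ×
  (∀ v → f v < k → k + activeNbrs m n f v ≤ closedSum m n f v)

-- "γ_{[k]R}(C_m □ P_n) ≤ b" : the minimum weight is ≤ b, i.e. some [k]RDF has weight ≤ b
γkR-CP-≤ : (k m n b : ℕ) → Set
γkR-CP-≤ k m n b = ∃ λ (f : Vertex m n → ℕ) → IsKRDF k m n f × weight m n f ≤ b

-- ⌈a / b⌉ for b > 0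
⌈_/_⌉ : ℕ → (b : ℕ) → ℕ
⌈ a / zero ⌉  = 0
⌈ a / suc b ⌉ = (a + b) / suc b

bound10 : ℕ → ℕ → ℕ
bound10 n k = 6 * (n ∸ 2) * ⌈ k + 4 / 5 ⌉ + 12 * ⌈ k + 3 ∸ ⌈ k + 4 / 5 ⌉ / 3 ⌉

{-# OPTIONS --safe #-}
-- Put A = ⌈(k+4)/5⌉ on the interior rows of C₆ □ Pₙ and B = ⌈(k+3−A)/3⌉ on its two boundary rows.
-- All values are positive, so the [k]-condition at v says f(v) + Σ_{u ∈ N(v)} (f(u) − 1) ≥ k.
-- Both cycle neighbours of v carry the value of v, so this reads 3B + A − 3 ≥ k on a boundary row
-- and 4A + c − 4 ≥ k on an interior row, where c ∈ {A, B} is the value of the second path neighbour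
-- (for n ≥ 4 one path neighbour of an interior vertex is interior); both follow from 5A ≥ k + 4 and
-- 3B + A ≥ k + 3. The weight is 6(n−2)A + 12B, and 5A ≤ k + 8, 3B + A ≤ k + 5 bound it as claimed.
module Submission where

open import Defs
open import Data.Bool using (T; T?; true; false; if_then_else_)
open import Data.Bool.Properties using (T-∨; T-∧)
open import Data.Fin using (Fin; zero; suc; toℕ; fromℕ; fromℕ<; inject₁)
open import Data.Fin.Properties using (toℕ-fromℕ; toℕ-fromℕ<; toℕ-inject₁; toℕ-injective; toℕ<n)
open import Data.List using (List; []; _∷_; _++_; map; length; filterᵇ; allFin; tabulate; applyUpTo; cartesianProduct)
open import Data.List.Properties using (map-++; map-∘; map-tabulate; length-tabulate)
open import Data.List.Membership.Propositional.Properties using (∈-∃++; ∈-filter⁺; ∈-cartesianProduct⁺; ∈-allFin)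
open import Data.List.Relation.Binary.Permutation.Propositional.Properties using (shift; ∈-resp-↭) renaming (map⁺ to ↭-map⁺)
open import Data.List.Relation.Binary.Subset.Propositional using (_⊆_)
open import Data.List.Relation.Unary.All as All using (All; []; _∷_)
open import Data.List.Relation.Unary.All.Properties using () renaming (map⁺ to All-map⁺)
open import Data.List.Relation.Unary.AllPairs using ([]; _∷_)
open import Data.List.Relation.Unary.Any using (here; there)
open import Data.List.Relation.Unary.Unique.Propositional using (Unique)
open import Data.List.Relation.Unary.Unique.Propositional.Properties using (Unique[x∷xs]⇒x∉xs) renaming (map⁺ to Unique-map⁺)
open import Data.Nat using (ℕ; zero; suc; _+_; _*_; _∸_; _/_; _≤_; _<_; _≡ᵇ_; _<ᵇ_; z≤n; s≤s; s≤s⁻¹; NonZero)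
open import Data.Nat.DivMod using (_%_; m/n*n≤m; m≡m%n+[m/n]*n; m%n<n; m<n⇒m%n≡m; n%n≡0; %-distribˡ-+)
open import Data.Nat.Divisibility using (divides; ∣⇒≤)
open import Data.Nat.ListAction using (sum)
open import Data.Nat.ListAction.Properties using (sum-++; sum-↭)
open import Data.Nat.Properties
open import Algebra.Properties.CommutativeSemigroup +-commutativeSemigroup using (x∙yz≈y∙xz)
open import Data.Nat.Tactic.RingSolver using (solve-∀)
open import Data.Product using (_×_; _,_; proj₁; proj₂; ∃-syntax)
open import Data.Sum using (_⊎_; inj₁; inj₂)
open import Function using (_∘_)
open import Function.Bundles using (Equivalence)
open import Relation.Binary.PropositionalEquality
open import Relation.Nullary using (contradiction)

open Equivalence using (from)

module _ {V : Set} where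

  count-positive+sum-pred≡sum : (f : V → ℕ) (xs : List V) →
    length (filterᵇ (λ u → 0 <ᵇ f u) xs) + sum (map (λ u → f u ∸ 1) xs) ≡ sum (map f xs)
  count-positive+sum-pred≡sum f [] = refl
  count-positive+sum-pred≡sum f (x ∷ xs) with f x
  ... | zero  = count-positive+sum-pred≡sum f xs
  ... | suc c = cong suc (trans (x∙yz≈y∙xz (length positives) c (sum (map (λ u → f u ∸ 1) xs)))
                               (cong (c +_) (count-positive+sum-pred≡sum f xs)))
    where positives = filterᵇ (λ u → 0 <ᵇ f u) xs

  Unique-⊆⇒sum-map-≤ : (h : V → ℕ) {xs ys : List V} → Unique xs → xs ⊆ ys → sum (map h xs) ≤ sum (map h ys)
  Unique-⊆⇒sum-map-≤ h {[]} _ _ = z≤n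
  Unique-⊆⇒sum-map-≤ h {x ∷ xs} {ys} (x∉xs ∷ xs-unique) xs⊆ys with ∈-∃++ (xs⊆ys (here refl))
  ... | ys₁ , ys₂ , refl = begin
    h x + sum (map h xs)            ≤⟨ +-monoʳ-≤ (h x) (Unique-⊆⇒sum-map-≤ h xs-unique xs⊆ys₁++ys₂) ⟩
    h x + sum (map h (ys₁ ++ ys₂))  ≡⟨ sum-↭ (↭-map⁺ h (shift x ys₁ ys₂)) ⟨
    sum (map h ys)                  ∎
    where
    open ≤-Reasoning
    xs⊆ys₁++ys₂ : xs ⊆ ys₁ ++ ys₂
    xs⊆ys₁++ys₂ y∈xs with ∈-resp-↭ (shift x ys₁ ys₂) (xs⊆ys (there y∈xs))
    ... | here refl = contradiction y∈xs (Unique[x∷xs]⇒x∉xs (x∉xs ∷ xs-unique))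
    ... | there y∈  = y∈

sum-map-proj₂-cartesianProduct : ∀ {A B : Set} (g : B → ℕ) (xs : List A) (ys : List B) →
  sum (map (g ∘ proj₂) (cartesianProduct xs ys)) ≡ length xs * sum (map g ys)
sum-map-proj₂-cartesianProduct g [] ys = refl
sum-map-proj₂-cartesianProduct g (x ∷ xs) ys = begin
  sum (map (g ∘ proj₂) (map (x ,_) ys ++ cartesianProduct xs ys))
    ≡⟨ cong sum (map-++ (g ∘ proj₂) (map (x ,_) ys) _) ⟩
  sum (map (g ∘ proj₂) (map (x ,_) ys) ++ map (g ∘ proj₂) (cartesianProduct xs ys))
    ≡⟨ sum-++ (map (g ∘ proj₂) (map (x ,_) ys)) _ ⟩
  sum (map (g ∘ proj₂) (map (x ,_) ys)) + sum (map (g ∘ proj₂) (cartesianProduct xs ys))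
    ≡⟨ cong₂ _+_ (cong sum (sym (map-∘ ys))) (sum-map-proj₂-cartesianProduct g xs ys) ⟩
  sum (map g ys) + length xs * sum (map g ys) ∎
  where open ≡-Reasoning

tabulate-toℕ≡applyUpTo : ∀ {A : Set} n (p : ℕ → A) → tabulate {n = n} (p ∘ toℕ) ≡ applyUpTo p n
tabulate-toℕ≡applyUpTo zero    p = refl
tabulate-toℕ≡applyUpTo (suc n) p = cong (p 0 ∷_) (tabulate-toℕ≡applyUpTo n (p ∘ suc))

sum-applyUpTo-constant-but-last : ∀ m {c} (p : ℕ → ℕ) → (∀ {t} → t < m → p t ≡ c) →
  sum (applyUpTo p (suc m)) ≡ m * c + p m
sum-applyUpTo-constant-but-last zero    p _ = +-identityʳ (p 0)
sum-applyUpTo-constant-but-last (suc m) {c} p constant = begin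
  p 0 + sum (applyUpTo (p ∘ suc) (suc m))
    ≡⟨ cong₂ _+_ (constant (s≤s z≤n)) (sum-applyUpTo-constant-but-last m (p ∘ suc) (constant ∘ s≤s)) ⟩
  c + (m * c + p (suc m))  ≡⟨ +-assoc c (m * c) (p (suc m)) ⟨
  suc m * c + p (suc m)    ∎
  where open ≡-Reasoning

[m+d]%n≢m : ∀ m d n .{{_ : NonZero n}} → suc d < n → (m + suc d) % n ≢ m
[m+d]%n≢m m d n d<n eq = <⇒≱ d<n (∣⇒≤ (divides ((m + suc d) / n) (+-cancelˡ-≡ m _ _ (begin
  m + suc d                              ≡⟨ m≡m%n+[m/n]*n (m + suc d) n ⟩
  (m + suc d) % n + (m + suc d) / n * n  ≡⟨ cong (_+ (m + suc d) / n * n) eq ⟩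
  m + (m + suc d) / n * n                ∎))))
  where open ≡-Reasoning

module _ {m : ℕ} where

  next : Fin (suc m) → Fin (suc m)
  next i = fromℕ< (m%n<n (toℕ i + 1) (suc m))

  prev : Fin (suc m) → Fin (suc m)
  prev zero    = fromℕ m
  prev (suc i) = inject₁ i

  toℕ-next : ∀ i → toℕ (next i) ≡ (toℕ i + 1) % suc m
  toℕ-next i = toℕ-fromℕ< (m%n<n (toℕ i + 1) (suc m))

  next-prev : ∀ i → next (prev i) ≡ i
  next-prev i = toℕ-injective (trans (toℕ-next (prev i)) (wraps i))
    where
    open ≡-Reasoning
    wraps : ∀ i → (toℕ (prev i) + 1) % suc m ≡ toℕ i
    wraps zero = begin
      (toℕ (fromℕ m) + 1) % suc m  ≡⟨ cong (λ x → (x + 1) % suc m) (toℕ-fromℕ m) ⟩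
      (m + 1) % suc m              ≡⟨ cong (_% suc m) (+-comm m 1) ⟩
      suc m % suc m                ≡⟨ n%n≡0 (suc m) ⟩
      0                            ∎
    wraps (suc i) = begin
      (toℕ (inject₁ i) + 1) % suc m  ≡⟨ cong (λ x → (x + 1) % suc m) (toℕ-inject₁ i) ⟩
      (toℕ i + 1) % suc m            ≡⟨ cong (_% suc m) (+-comm (toℕ i) 1) ⟩
      suc (toℕ i) % suc m            ≡⟨ m<n⇒m%n≡m (s≤s (toℕ<n i)) ⟩
      suc (toℕ i)                    ∎

  cycAdj-next : ∀ i → T (cycAdj (suc m) i (next i))
  cycAdj-next i = from T-∨ (inj₁ (≡⇒≡ᵇ _ _ (toℕ-next i)))

  cycAdj-prev : ∀ i → T (cycAdj (suc m) i (prev i))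
  cycAdj-prev i = from T-∨ (inj₂ (≡⇒≡ᵇ _ _ (trans (cong toℕ (sym (next-prev i))) (toℕ-next (prev i)))))

  next≢id : 1 ≤ m → ∀ i → next i ≢ i
  next≢id 1≤m i eq = [m+d]%n≢m (toℕ i) 0 (suc m) (s≤s 1≤m) (trans (sym (toℕ-next i)) (cong toℕ eq))

  prev≢id : 1 ≤ m → ∀ i → prev i ≢ i
  prev≢id 1≤m i eq = next≢id 1≤m (prev i) (trans (next-prev i) (sym eq))

  prev≢next : 2 ≤ m → ∀ i → prev i ≢ next i
  prev≢next 2≤m i eq = [m+d]%n≢m (toℕ p) 1 (suc m) (s≤s 2≤m) (begin
    (toℕ p + 2) % suc m                        ≡⟨ cong (_% suc m) (+-assoc (toℕ p) 1 1) ⟨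
    (toℕ p + 1 + 1) % suc m                    ≡⟨ %-distribˡ-+ (toℕ p + 1) 1 (suc m) ⟩
    ((toℕ p + 1) % suc m + 1 % suc m) % suc m  ≡⟨ cong (λ x → (x + 1 % suc m) % suc m) (toℕ-next p) ⟨
    (toℕ (next p) + 1 % suc m) % suc m         ≡⟨ cong (λ x → (toℕ (next p) + x) % suc m) 1%[1+m]≡1 ⟩
    (toℕ (next p) + 1) % suc m                 ≡⟨ toℕ-next (next p) ⟨
    toℕ (next (next p))                        ≡⟨ cong (toℕ ∘ next) (next-prev i) ⟩
    toℕ (next i)                               ≡⟨ cong toℕ eq ⟨
    toℕ p                                      ∎)
    where
    open ≡-Reasoning
    p = prev i
    1%[1+m]≡1 : 1 % suc m ≡ 1
    1%[1+m]≡1 = m<n⇒m%n≡m (s≤s (≤-trans (s≤s z≤n) 2≤m))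

adj-horizontal : ∀ {m n} (i i′ : Fin m) (j : Fin n) → T (cycAdj m i i′) → T (adj m n (i , j) (i′ , j))
adj-horizontal _ _ j i~i′ = from T-∨ (inj₂ (from T-∧ (≡⇒≡ᵇ (toℕ j) (toℕ j) refl , i~i′)))

adj-vertical : ∀ {m n} (i : Fin m) (j j′ : Fin n) → T (pathAdj n j j′) → T (adj m n (i , j) (i , j′))
adj-vertical i _ _ j~j′ = from T-∨ (inj₁ (from T-∧ (≡⇒≡ᵇ (toℕ i) (toℕ i) refl , j~j′)))

pathAdj-up : ∀ {n} {j j′ : Fin n} → toℕ j′ ≡ suc (toℕ j) → T (pathAdj n j j′)
pathAdj-up eq = from T-∨ (inj₁ (≡⇒≡ᵇ _ _ eq))

pathAdj-down : ∀ {n} {j j′ : Fin n} → toℕ j ≡ suc (toℕ j′) → T (pathAdj n j j′)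
pathAdj-down eq = from T-∨ (inj₂ (≡⇒≡ᵇ _ _ eq))

domination-via-neighbours : ∀ {m n} k (f : Vertex m n → ℕ) v (xs : List (Vertex m n)) →
  Unique xs → All (T ∘ adj m n v) xs → k ≤ f v + sum (map (λ u → f u ∸ 1) xs) →
  k + activeNbrs m n f v ≤ closedSum m n f v
domination-via-neighbours {m} {n} k f v xs xs-unique xs-adjacent covered = begin
  k + active                            ≤⟨ +-monoˡ-≤ active (≤-trans covered (+-monoʳ-≤ (f v) xs-sum≤)) ⟩
  f v + sum (map pred-f Nv) + active    ≡⟨ +-assoc (f v) _ active ⟩
  f v + (sum (map pred-f Nv) + active)  ≡⟨ cong (f v +_) (+-comm (sum (map pred-f Nv)) active) ⟩
  f v + (active + sum (map pred-f Nv))  ≡⟨ cong (f v +_) (count-positive+sum-pred≡sum f Nv) ⟩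
  closedSum m n f v                     ∎
  where
  open ≤-Reasoning
  Nv = N m n v
  active = activeNbrs m n f v
  pred-f : Vertex m n → ℕ
  pred-f u = f u ∸ 1
  xs⊆Nv : xs ⊆ Nv
  xs⊆Nv {i , j} u∈xs =
    ∈-filter⁺ (T? ∘ adj m n v) (∈-cartesianProduct⁺ (∈-allFin i) (∈-allFin j)) (All.lookup xs-adjacent u∈xs)
  xs-sum≤ : sum (map pred-f xs) ≤ sum (map pred-f Nv)
  xs-sum≤ = Unique-⊆⇒sum-map-≤ pred-f xs-unique xs⊆Nv

-- The [k]-condition at (i , j) for the row-constant function (i , j) ↦ g j on C_m □ P_n:
-- the factor 2 accounts for the two cycle neighbours, which also carry g j.
PathSupport : (k n : ℕ) → (Fin n → ℕ) → Fin n → Set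
PathSupport k n g j = ∃[ js ] Unique js × All (T ∘ pathAdj n j) js
  × k ≤ g j + 2 * (g j ∸ 1) + sum (map (λ j′ → g j′ ∸ 1) js)

rowConstant-domination : ∀ {m n} k (g : Fin n → ℕ) → 3 ≤ m → (∀ j → PathSupport k n g j) →
  ∀ v → k + activeNbrs m n (g ∘ proj₂) v ≤ closedSum m n (g ∘ proj₂) v
rowConstant-domination {suc m} {n} k g (s≤s 2≤m) support (i , j) with support j
... | js , js-unique , js-adjacent , covered =
  domination-via-neighbours k f (i , j) xs xs-unique xs-adjacent (subst (k ≤_) rearrange covered)
  where
  f : Vertex (suc m) n → ℕ
  f = g ∘ proj₂
  1≤m = ≤-trans (s≤s z≤n) 2≤m
  xs = (prev i , j) ∷ (next i , j) ∷ map (i ,_) js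
  off-column : ∀ {i′} → i′ ≢ i → All (λ j′ → (i′ , j) ≢ (i , j′)) js
  off-column i′≢i = All.universal (λ _ eq → i′≢i (cong proj₁ eq)) js
  xs-unique : Unique xs
  xs-unique = ((λ eq → prev≢next 2≤m i (cong proj₁ eq)) ∷ All-map⁺ (off-column (prev≢id 1≤m i)))
            ∷ All-map⁺ (off-column (next≢id 1≤m i))
            ∷ Unique-map⁺ (cong proj₂) js-unique
  xs-adjacent : All (T ∘ adj (suc m) n (i , j)) xs
  xs-adjacent = adj-horizontal i (prev i) j (cycAdj-prev i)
              ∷ adj-horizontal i (next i) j (cycAdj-next i)
              ∷ All-map⁺ (All.map (adj-vertical i j _) js-adjacent)
  rearrange : g j + 2 * (g j ∸ 1) + sum (map (λ j′ → g j′ ∸ 1) js)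
            ≡ f (i , j) + sum (map (λ u → f u ∸ 1) xs)
  rearrange = trans (shape (g j) (g j ∸ 1) _) (cong (λ s → g j + (g j ∸ 1 + (g j ∸ 1 + sum s))) (map-∘ js))
    where
    shape : ∀ x y s → x + 2 * y + s ≡ x + (y + (y + s))
    shape = solve-∀

boundaryProfile : (n A B : ℕ) → ℕ → ℕ
boundaryProfile n A B zero    = B
boundaryProfile n A B (suc t) = if suc (suc t) ≡ᵇ n then B else A

module _ {A B : ℕ} where

  boundaryProfile-last : ∀ {n t} → suc (suc t) ≡ n → boundaryProfile n A B (suc t) ≡ B
  boundaryProfile-last {t = t} refl with t ≡ᵇ t | ≡⇒≡ᵇ t t refl
  ... | true | _ = refl

  boundaryProfile-interior : ∀ {n t} → suc (suc t) < n → boundaryProfile n A B (suc t) ≡ A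
  boundaryProfile-interior {n} {t} t+2<n with suc (suc t) ≡ᵇ n | ≡ᵇ⇒≡ (suc (suc t)) n
  ... | false | _  = refl
  ... | true  | eq = contradiction (eq _) (<⇒≢ t+2<n)

  boundaryProfile-cases : ∀ n t → boundaryProfile n A B t ≡ A ⊎ boundaryProfile n A B t ≡ B
  boundaryProfile-cases n zero = inj₂ refl
  boundaryProfile-cases n (suc t) with suc (suc t) ≡ᵇ n
  ... | true  = inj₂ refl
  ... | false = inj₁ refl

  sum-boundaryProfile : ∀ m → sum (map (boundaryProfile (2 + m) A B ∘ toℕ) (allFin (2 + m))) ≡ B + (m * A + B)
  sum-boundaryProfile m = begin
    sum (map (P ∘ toℕ) (allFin (2 + m)))     ≡⟨ cong sum (map-tabulate {n = 2 + m} (λ j → j) (P ∘ toℕ)) ⟩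
    sum (tabulate {n = 2 + m} (P ∘ toℕ))     ≡⟨ cong sum (tabulate-toℕ≡applyUpTo (2 + m) P) ⟩
    P 0 + sum (applyUpTo (P ∘ suc) (suc m))
      ≡⟨ cong (B +_) (sum-applyUpTo-constant-but-last m (P ∘ suc) (boundaryProfile-interior ∘ s≤s ∘ s≤s)) ⟩
    B + (m * A + P (suc m))                  ≡⟨ cong (λ x → B + (m * A + x)) (boundaryProfile-last {t = m} refl) ⟩
    B + (m * A + B)                          ∎
    where
    open ≡-Reasoning
    P = boundaryProfile (2 + m) A B

  boundaryProfile-≤ : ∀ {x} → A ≤ x → B ≤ x → ∀ n t → boundaryProfile n A B t ≤ x
  boundaryProfile-≤ A≤x B≤x n t with boundaryProfile-cases n t
  ... | inj₁ eq = subst (_≤ _) (sym eq) A≤x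
  ... | inj₂ eq = subst (_≤ _) (sym eq) B≤x

  weight-boundaryProfile : ∀ c r → weight c (2 + r) (boundaryProfile (2 + r) A B ∘ toℕ ∘ proj₂) ≡ c * r * A + 2 * c * B
  weight-boundaryProfile c r = begin
    weight c (2 + r) (P ∘ toℕ ∘ proj₂)
      ≡⟨ sum-map-proj₂-cartesianProduct (P ∘ toℕ) (allFin c) (allFin (2 + r)) ⟩
    length (allFin c) * sum (map (P ∘ toℕ) (allFin (2 + r)))
      ≡⟨ cong₂ _*_ (length-tabulate {n = c} (λ i → i)) (sum-boundaryProfile r) ⟩
    c * (B + (r * A + B))  ≡⟨ collect c r A B ⟩
    c * r * A + 2 * c * B  ∎
    where
    open ≡-Reasoning
    P = boundaryProfile (2 + r) A B
    collect : ∀ c r A B → c * (B + (r * A + B)) ≡ c * r * A + 2 * c * B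
    collect = solve-∀

module _ {k A B : ℕ} (m : ℕ)
  (end-ok : k ≤ B + 2 * (B ∸ 1) + (A ∸ 1))
  (interior-ok : ∀ {c} → c ≡ A ⊎ c ≡ B → k ≤ A + 2 * (A ∸ 1) + ((A ∸ 1) + (c ∸ 1)))
  where

  private
    n = 4 + m
    g : Fin n → ℕ
    g = boundaryProfile n A B ∘ toℕ

    end-support : ∀ {j} x → g j ≡ B → g x ≡ A → T (pathAdj n j x) → PathSupport k n g j
    end-support {j} x gj gx j~x = x ∷ [] , [] ∷ [] , j~x ∷ [] , covered
      where
      covered : k ≤ g j + 2 * (g j ∸ 1) + ((g x ∸ 1) + 0)
      covered rewrite gj | gx | +-identityʳ (A ∸ 1) = end-ok

    interior-support : ∀ {j} x y → g j ≡ A → g x ≡ A → T (pathAdj n j x) → T (pathAdj n j y) → x ≢ y →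
      PathSupport k n g j
    interior-support {j} x y gj gx j~x j~y x≢y =
      x ∷ y ∷ [] , (x≢y ∷ []) ∷ [] ∷ [] , j~x ∷ j~y ∷ [] , covered
      where
      covered : k ≤ g j + 2 * (g j ∸ 1) + ((g x ∸ 1) + ((g y ∸ 1) + 0))
      covered rewrite gj | gx | +-identityʳ (g y ∸ 1) = interior-ok (boundaryProfile-cases n (toℕ y))

  boundaryProfile-support : ∀ j → PathSupport k n g j
  -- Since n = 4 + m, the values B, A, A of rows 0, 1, 2 and their adjacencies hold by computation.
  boundaryProfile-support zero = end-support (suc zero) refl refl _
  boundaryProfile-support (suc zero) =
    interior-support (suc (suc zero)) zero refl refl _ _ (λ ())
  boundaryProfile-support j@(suc (suc j″)) = beyond-second (m≤n⇒m<n∨m≡n (toℕ<n j))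
    where
    down : Fin n
    down = inject₁ (suc j″)
    down-value : g down ≡ A
    down-value = trans (cong (boundaryProfile n A B) (toℕ-inject₁ (suc j″))) (boundaryProfile-interior (toℕ<n j))
    j~down : T (pathAdj n j down)
    j~down = pathAdj-down (cong suc (sym (toℕ-inject₁ (suc j″))))
    beyond-second : suc (toℕ j) < n ⊎ suc (toℕ j) ≡ n → PathSupport k n g j
    beyond-second (inj₁ interior) = interior-support down up
        (boundaryProfile-interior interior) down-value j~down (pathAdj-up (toℕ-fromℕ< interior)) down≢up
      where
      up = fromℕ< interior
      down≢up : down ≢ up
      down≢up eq = <⇒≢ (m<n⇒m<1+n (n<1+n (toℕ (suc j″))))
        (trans (sym (toℕ-inject₁ (suc j″))) (trans (cong toℕ eq) (toℕ-fromℕ< interior)))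
    beyond-second (inj₂ last) = end-support down (boundaryProfile-last last) down-value j~down
m≤⌈m/n⌉*n : ∀ m d → m ≤ ⌈ m / suc d ⌉ * suc d
m≤⌈m/n⌉*n m d = +-cancelʳ-≤ d m _ (begin
  m + d                                     ≡⟨ m≡m%n+[m/n]*n (m + d) (suc d) ⟩
  (m + d) % suc d + ⌈ m / suc d ⌉ * suc d   ≤⟨ +-monoˡ-≤ _ (s≤s⁻¹ (m%n<n (m + d) (suc d))) ⟩
  d + ⌈ m / suc d ⌉ * suc d                 ≡⟨ +-comm d _ ⟩
  ⌈ m / suc d ⌉ * suc d + d                 ∎)
  where open ≤-Reasoning

⌈m/n⌉*n≤m+n∸1 : ∀ m d → ⌈ m / suc d ⌉ * suc d ≤ m + d
⌈m/n⌉*n≤m+n∸1 m d = m/n*n≤m (m + d) (suc d)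

m+o≡n⇒m≤n : ∀ {m n} o → m + o ≡ n → m ≤ n
m+o≡n⇒m≤n {m} o eq = subst (m ≤_) eq (m≤m+n m o)

interiorValue : ℕ → ℕ
interiorValue k = ⌈ k + 4 / 5 ⌉

endValue : ℕ → ℕ
endValue k = ⌈ k + 3 ∸ interiorValue k / 3 ⌉

interiorValue-lower : ∀ k → k + 4 ≤ 5 * interiorValue k
interiorValue-lower k = subst (k + 4 ≤_) (*-comm (interiorValue k) 5) (m≤⌈m/n⌉*n (k + 4) 4)

interiorValue-upper : ∀ k → 5 * interiorValue k ≤ k + 8
interiorValue-upper k = subst₂ _≤_ (*-comm (interiorValue k) 5) (+-assoc k 4 4) (⌈m/n⌉*n≤m+n∸1 (k + 4) 4)

interiorValue≤k+3 : ∀ k → interiorValue k ≤ k + 3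
interiorValue≤k+3 k = *-cancelˡ-≤ 5 (≤-trans (interiorValue-upper k) (m+o≡n⇒m≤n (4 * k + 7) (eq k)))
  where
  eq : ∀ k → k + 8 + (4 * k + 7) ≡ 5 * (k + 3)
  eq = solve-∀

endValue-lower : ∀ k → k + 3 ≤ 3 * endValue k + interiorValue k
endValue-lower k = begin
  k + 3                  ≡⟨ m∸n+n≡m (interiorValue≤k+3 k) ⟨
  k + 3 ∸ A + A          ≤⟨ +-monoˡ-≤ A (m≤⌈m/n⌉*n (k + 3 ∸ A) 2) ⟩
  endValue k * 3 + A     ≡⟨ cong (_+ A) (*-comm (endValue k) 3) ⟩
  3 * endValue k + A     ∎
  where
  open ≤-Reasoning
  A = interiorValue k

endValue-upper : ∀ k → 3 * endValue k + interiorValue k ≤ k + 5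
endValue-upper k = begin
  3 * endValue k + A     ≡⟨ cong (_+ A) (*-comm 3 (endValue k)) ⟩
  endValue k * 3 + A     ≤⟨ +-monoˡ-≤ A (⌈m/n⌉*n≤m+n∸1 (k + 3 ∸ A) 2) ⟩
  k + 3 ∸ A + 2 + A      ≡⟨ swap (k + 3 ∸ A) A ⟩
  k + 3 ∸ A + A + 2      ≡⟨ cong (_+ 2) (m∸n+n≡m (interiorValue≤k+3 k)) ⟩
  k + 3 + 2              ≡⟨ +-assoc k 3 2 ⟩
  k + 5                  ∎
  where
  open ≤-Reasoning
  A = interiorValue k
  swap : ∀ x y → x + 2 + y ≡ x + y + 2
  swap = solve-∀

interiorValue≤k+1 : ∀ {k} → 1 ≤ k → interiorValue k ≤ k + 1
interiorValue≤k+1 {suc k} _ = *-cancelˡ-≤ 5 (≤-trans (interiorValue-upper (suc k)) (m+o≡n⇒m≤n (4 * k + 1) (eq k)))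
  where
  eq : ∀ k → suc k + 8 + (4 * k + 1) ≡ 5 * (suc k + 1)
  eq = solve-∀

endValue≤k+1 : ∀ {k} → 1 ≤ k → endValue k ≤ k + 1
endValue≤k+1 {suc k} _ = *-cancelˡ-≤ 3 (begin
  3 * endValue (suc k)                          ≤⟨ m≤m+n _ (interiorValue (suc k)) ⟩
  3 * endValue (suc k) + interiorValue (suc k)  ≤⟨ endValue-upper (suc k) ⟩
  suc k + 5                                     ≤⟨ m+o≡n⇒m≤n (2 * k) (eq k) ⟩
  3 * (suc k + 1)                               ∎)
  where
  open ≤-Reasoning
  eq : ∀ k → suc k + 5 + 2 * k ≡ 3 * (suc k + 1)
  eq = solve-∀

interiorValue-positive : ∀ {k} → 1 ≤ k → 1 ≤ interiorValue k
interiorValue-positive {k} 1≤k = *-cancelˡ-≤ 5 (≤-trans (+-monoˡ-≤ 4 1≤k) (interiorValue-lower k))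

endValue-positive : ∀ {k} → 1 ≤ k → 1 ≤ endValue k
endValue-positive {k} 1≤k with endValue k | endValue-lower k
... | suc _ | _ = s≤s z≤n
... | zero  | k+3≤A with +-cancelˡ-≤ k 3 1 (≤-trans k+3≤A (interiorValue≤k+1 1≤k))
...   | s≤s ()

end-condition : ∀ {k A B} → 1 ≤ A → 1 ≤ B → k + 3 ≤ 3 * B + A → k ≤ B + 2 * (B ∸ 1) + (A ∸ 1)
end-condition {k} {suc a} {suc b} _ _ h = +-cancelʳ-≤ 3 k _ (subst (k + 3 ≤_) (eq a b) h)
  where
  eq : ∀ a b → 3 * suc b + suc a ≡ suc b + 2 * b + a + 3
  eq = solve-∀

k+4≤4A+B : ∀ {k A B} → k + 4 ≤ 5 * A → k + 3 ≤ 3 * B + A → k + 4 ≤ 4 * A + B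
k+4≤4A+B {k} {A} {B} lower₅ lower₃ with ≤-<-connex A B
... | inj₁ A≤B = ≤-trans lower₅ (subst (_≤ 4 * A + B) (eq A) (+-monoʳ-≤ (4 * A) A≤B))
  where
  eq : ∀ A → 4 * A + A ≡ 5 * A
  eq = solve-∀
... | inj₂ B<A = begin
  k + 4                ≡⟨ +-assoc k 3 1 ⟨
  k + 3 + 1            ≤⟨ +-monoˡ-≤ 1 lower₃ ⟩
  3 * B + A + 1        ≤⟨ n≤1+n _ ⟩
  suc (3 * B + A + 1)  ≡⟨ eq₁ A B ⟩
  B + A + 2 * suc B    ≤⟨ +-monoʳ-≤ (B + A) (*-monoʳ-≤ 2 B<A) ⟩
  B + A + 2 * A        ≤⟨ +-monoʳ-≤ (B + A) (*-monoˡ-≤ A (n≤1+n 2)) ⟩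
  B + A + 3 * A        ≡⟨ eq₂ A B ⟩
  4 * A + B            ∎
  where
  open ≤-Reasoning
  eq₁ : ∀ A B → suc (3 * B + A + 1) ≡ B + A + 2 * suc B
  eq₁ = solve-∀
  eq₂ : ∀ A B → B + A + 3 * A ≡ 4 * A + B
  eq₂ = solve-∀

interior-condition : ∀ {k A B c} → 1 ≤ A → 1 ≤ B → k + 4 ≤ 5 * A → k + 3 ≤ 3 * B + A →
  c ≡ A ⊎ c ≡ B → k ≤ A + 2 * (A ∸ 1) + ((A ∸ 1) + (c ∸ 1))
interior-condition {k} {suc a} {suc b} _ _ lower₅ _ (inj₁ refl) =
  +-cancelʳ-≤ 4 k _ (subst (k + 4 ≤_) (eq a) lower₅)
  where
  eq : ∀ a → 5 * suc a ≡ suc a + 2 * a + (a + a) + 4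
  eq = solve-∀
interior-condition {k} {suc a} {suc b} _ _ lower₅ lower₃ (inj₂ refl) =
  +-cancelʳ-≤ 4 k _ (subst (k + 4 ≤_) (eq a b) (k+4≤4A+B {A = suc a} {B = suc b} lower₅ lower₃))
  where
  eq : ∀ a b → 4 * suc a + suc b ≡ suc a + 2 * a + (a + b) + 4
  eq = solve-∀

weight-bound : ∀ m {k A B} → k + 4 ≤ 5 * A → 5 * A ≤ k + 8 → 3 * B + A ≤ k + 5 →
  5 * (6 * m * A + 12 * B) ≤ (6 * (2 + m) * k + 54 * (2 + m) + 4 * k) ∸ 4
weight-bound m {k} {A} {B} lower₅ upper₅ upper₃ = m+n≤o⇒m≤o∸n (5 * (6 * m * A + 12 * B)) {o = 6 * (2 + m) * k + 54 * (2 + m) + 4 * k} (+-cancelʳ-≤ (4 * (k + 4)) _ _ (begin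
  5 * (6 * m * A + 12 * B) + 4 + 4 * (k + 4)         ≤⟨ +-monoʳ-≤ (5 * (6 * m * A + 12 * B) + 4) (*-monoʳ-≤ 4 lower₅) ⟩
  5 * (6 * m * A + 12 * B) + 4 + 4 * (5 * A)         ≡⟨ regroup m A B ⟩
  6 * m * (5 * A) + 20 * (3 * B + A) + 4             ≤⟨ +-monoˡ-≤ 4 (+-mono-≤ (*-monoʳ-≤ (6 * m) upper₅) (*-monoʳ-≤ 20 upper₃)) ⟩
  6 * m * (k + 8) + 20 * (k + 5) + 4                 ≤⟨ m≤m+n _ (6 * m + 20) ⟩
  6 * m * (k + 8) + 20 * (k + 5) + 4 + (6 * m + 20)  ≡⟨ expand m k ⟩
  6 * (2 + m) * k + 54 * (2 + m) + 4 * k + 4 * (k + 4) ∎))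
  where
  open ≤-Reasoning
  regroup : ∀ m A B → 5 * (6 * m * A + 12 * B) + 4 + 4 * (5 * A) ≡ 6 * m * (5 * A) + 20 * (3 * B + A) + 4
  regroup = solve-∀
  expand : ∀ m k → 6 * m * (k + 8) + 20 * (k + 5) + 4 + (6 * m + 20) ≡ 6 * (2 + m) * k + 54 * (2 + m) + 4 * k + 4 * (k + 4)
  expand = solve-∀

theorem10 : (n k : ℕ) → 4 ≤ n → 1 ≤ k →
    γkR-CP-≤ k 6 n (bound10 n k)
    × 5 * bound10 n k ≤ (6 * n * k + 54 * n + 4 * k) ∸ 4
theorem10 (suc (suc (suc (suc m)))) k (s≤s (s≤s (s≤s (s≤s z≤n)))) 1≤k =
  (f , (bounded , λ v _ → dominated v) , ≤-reflexive (weight-boundaryProfile {A} {B} 6 (2 + m))) ,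
  weight-bound (2 + m) {k} {A} {B} (interiorValue-lower k) (interiorValue-upper k) (endValue-upper k)
  where
  A = interiorValue k
  B = endValue k
  g : Fin (4 + m) → ℕ
  g = boundaryProfile (4 + m) A B ∘ toℕ
  f : Vertex 6 (4 + m) → ℕ
  f = g ∘ proj₂
  bounded : ∀ v → f v ≤ k + 1
  bounded (_ , j) = boundaryProfile-≤ (interiorValue≤k+1 1≤k) (endValue≤k+1 1≤k) (4 + m) (toℕ j)
  A>0 = interiorValue-positive 1≤k
  B>0 = endValue-positive 1≤k
  dominated = rowConstant-domination k g (s≤s (s≤s (s≤s z≤n)))
    (boundaryProfile-support m
      (end-condition A>0 B>0 (endValue-lower k))
      (interior-condition A>0 B>0 (interiorValue-lower k) (endValue-lower k)))
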